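{- Let $L$ be any logic (set of theorems) with $\mathbf{IL}^-(\mathbf{J2})\subseteq L\subseteq\mathbf{IL}^-(\mathbf{J2},\mathbf{J4}_+,\mathbf{J5})$. Then $L$ is not complete with respect to $\mathbf{IL}^-$-frames: there is a formula valid in every $\mathbf{IL}^-$-frame in which all axioms of $L$ are valid but not provable in $L$.
   Context: Formulas are built from countably many propositional variables, $\top,\bot$, $\neg,\land,\lor,\to$, unary $\Box$ and binary $\rhd$; $\Diamond A$ abbreviates $\neg\Box\neg A$. The logic $\mathbf{IL}^-$ has as axioms all tautologies, $\Box(A\to B)\to(\Box A\to\Box B)$, $\Box(\Box A\to A)\to\Box A$, $(A\rhd C)\land(B\rhd C)\to(A\lor B)\rhd C$, and $\Box A\leftrightarrow(\neg A)\rhd\bot$; rules: modus ponens, necessitation, from $A\to B$ infer $C\rhd A\to C\rhd B$, from $A\to B$ infer $B\rhd C\to A\rhd C$. $\mathbf{IL}^-(\Sigma_1,\dots,\Sigma_n)$ is $\mathbf{IL}^-$ with schemata $\Sigma_i$ added as axioms. Schemata: $\mathbf{J2}$: $(A\rhd B)\land(B\rhd C)\to A\rhd C$; $\mathbf{J4}_+$: $\Box(A\to B)\to(C\rhd A\to C\rhd B)$; $\mathbf{J5}$: $\Diamond A\rhd A$. An $\mathbf{IL}^-$-frame is a triple $\langle W,R,\{S_x\}_{x\in W}\rangle$ with $W$ nonempty, $R$ transitive and conversely well-founded on $W$, each $S_x$ a binary relation on $W$ with $yS_xz\Rightarrow xRy$. Satisfaction: usual Boolean clauses, $x\Vdash\Box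 A$ iff $y\Vdash A$ for all $y$ with $xRy$, $x\Vdash A\rhd B$ iff for every $y$ with $xRy$, $y\Vdash A$ there is $z$ with $yS_xz$, $z\Vdash B$. Validity in a frame: truth at every point under every satisfaction relation (for schemata: all instances). -}

module Defs where

open import Data.Nat using (ℕ)
open import Data.Bool using (Bool; true; false; not; _∧_; _∨_)
open import Data.Product using (Σ; _×_; ∃-syntax)
open import Data.Sum using (_⊎_)
open import Data.Empty using (⊥)
open import Data.Unit using (⊤)
open import Relation.Nullary using (¬_)
open import Relation.Binary.PropositionalEquality using (_≡_)
open import Relation.Binary using (Rel; Transitive)
open import Induction.WellFounded using (WellFounded)
open import Function using (flip)

infixr 5 _⇒_
infixr 6 _∨'_
infixr 7 _∧'_
infix 8 _▷_
infix 4 _⇔_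
infix 9 □_ ◇_ ¬'_

data Formula : Set where
  var   : ℕ → Formula
  ⊤'    : Formula
  ⊥'    : Formula
  ¬'_   : Formula → Formula
  _∧'_  : Formula → Formula → Formula
  _∨'_  : Formula → Formula → Formula
  _⇒_   : Formula → Formula → Formula
  □_    : Formula → Formula
  _▷_   : Formula → Formula → Formula

◇_ : Formula → Formula
◇ A = ¬' (□ (¬' A))

_⇔_ : Formula → Formula → Formula
A ⇔ B = (A ⇒ B) ∧' (B ⇒ A)

-- Tautologies: formulas true under every Boolean assignment to the
-- "propositional atoms" (variables, □-formulas and ▷-formulas), i.e.
-- substitution instances of propositional tautologies.

evalB : (Formula → Bool) → Formula → Bool
evalB v (var n)  = v (var n)
evalB v ⊤'       = true
evalB v ⊥'       = false
evalB v (¬' A)   = not (evalB v A)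
evalB v (A ∧' B) = evalB v A ∧ evalB v B
evalB v (A ∨' B) = evalB v A ∨ evalB v B
evalB v (A ⇒ B)  = not (evalB v A) ∨ evalB v B
evalB v (□ A)    = v (□ A)
evalB v (A ▷ B)  = v (A ▷ B)

Tautology : Formula → Set
Tautology A = (v : Formula → Bool) → evalB v A ≡ true

data _⊢_ (Ax : Formula → Set) : Formula → Set where
  taut : ∀ {A} → Tautology A → Ax ⊢ A
  axK  : ∀ {A B} → Ax ⊢ (□ (A ⇒ B) ⇒ (□ A ⇒ □ B))
  axL  : ∀ {A} → Ax ⊢ (□ (□ A ⇒ A) ⇒ □ A)
  axJ3 : ∀ {A B C} → Ax ⊢ ((A ▷ C) ∧' (B ▷ C) ⇒ (A ∨' B) ▷ C)
  axJ6 : ∀ {A} → Ax ⊢ (□ A ⇔ ((¬' A) ▷ ⊥'))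
  extra : ∀ {A} → Ax A → Ax ⊢ A
  mp   : ∀ {A B} → Ax ⊢ (A ⇒ B) → Ax ⊢ A → Ax ⊢ B
  nec  : ∀ {A} → Ax ⊢ A → Ax ⊢ (□ A)
  ruleR : ∀ {A B C} → Ax ⊢ (A ⇒ B) → Ax ⊢ (C ▷ A ⇒ C ▷ B)
  ruleL : ∀ {A B C} → Ax ⊢ (A ⇒ B) → Ax ⊢ (B ▷ C ⇒ A ▷ C)

data J2 : Formula → Set where
  j2 : ∀ A B C → J2 ((A ▷ B) ∧' (B ▷ C) ⇒ A ▷ C)

data J4+ : Formula → Set where
  j4+ : ∀ A B C → J4+ (□ (A ⇒ B) ⇒ (C ▷ A ⇒ C ▷ B))

data J5 : Formula → Set where
  j5 : ∀ A → J5 ((◇ A) ▷ A)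

ILm-J2 : Formula → Set
ILm-J2 A = J2 ⊢ A

J2J4+J5 : Formula → Set
J2J4+J5 A = J2 A ⊎ J4+ A ⊎ J5 A

ILm-J2J4+J5 : Formula → Set
ILm-J2J4+J5 A = J2J4+J5 ⊢ A

record Frame : Set₁ where
  field
    W     : Set
    inhabited : W
    R     : Rel W _
    S     : W → Rel W _
    R-trans : Transitive R
    R-cwf   : WellFounded (flip R)
    S-R     : ∀ {x y z} → S x y z → R x y

module _ (F : Frame) where
  open Frame F

  _,_⊩_ : (ℕ → W → Set) → W → Formula → Set
  V , x ⊩ var n  = V n x
  V , x ⊩ ⊤'     = ⊤
  V , x ⊩ ⊥'     = ⊥
  V , x ⊩ (¬' A) = ¬ (V , x ⊩ A)
  V , x ⊩ (A ∧' B) = (V , x ⊩ A) × (V , x ⊩ B)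
  V , x ⊩ (A ∨' B) = (V , x ⊩ A) ⊎ (V , x ⊩ B)
  V , x ⊩ (A ⇒ B)  = (V , x ⊩ A) → (V , x ⊩ B)
  V , x ⊩ (□ A)    = ∀ y → R x y → V , y ⊩ A
  V , x ⊩ (A ▷ B)  = ∀ y → R x y → V , y ⊩ A → ∃[ z ] (S x y z × V , z ⊩ B)

  Valid : Formula → Set₁
  Valid A = (V : ℕ → W → Set) (x : W) → V , x ⊩ A

ValidSet : Frame → (Formula → Set) → Set₁
ValidSet F L = ∀ A → L A → Valid F A

module Submission where

-- Proof idea.  The separating formula is the strengthened transitivity
-- principle  J2⁺ = (p ▷ (q ∨ r)) ∧ (q ▷ r) → p ▷ r.
--
--  * Frame side: in any IL⁻-frame validating every instance of J2, J2⁺ is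
--    valid.  Given an S_w-successor z of y with q at z, apply the J2
--    instance ({y} ▷ {z}) ∧ ({z} ▷ r) → {y} ▷ r under a valuation making
--    the first two atoms the singletons {y} and {z}.
--  * Syntactic side: IL⁻(J2, J4₊, J5) is sound for a four-point Boolean
--    model (a root over three end points a, b, c) in which ▷ at the root
--    reads "every S-successor of an antecedent point satisfies the
--    consequent" for S(a) = {b,c}, S(b) = {c}, S(c) = {b,c}.  J2⁺ fails at
--    the root, so it is not a theorem of IL⁻(J2, J4₊, J5).
--
-- Any L between the two logics contains J2 (so J2⁺ is valid in its frames)
-- and is contained in IL⁻(J2, J4₊, J5) (so J2⁺ is not in L).

open import Defs
open import Data.Product using (Σ; _×_; _,_)
open import Relation.Nullary using (¬_)

open import Data.Nat using (ℕ; zero; suc)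
open import Data.Bool using (Bool; true; false; not; _∧_; _∨_)
open import Data.Bool.Properties using (∧-conicalˡ; ∧-conicalʳ)
open import Data.Sum using (inj₁; inj₂)
open import Relation.Binary.PropositionalEquality
  using (_≡_; refl; sym; trans; cong; cong₂)

J2⁺ : Formula
J2⁺ = ((var 0 ▷ (var 1 ∨' var 2)) ∧' (var 1 ▷ var 2)) ⇒ var 0 ▷ var 2

module _ (F : Frame) where
  open Frame F

  J2-valid⇒J2⁺-valid : (∀ A B C → Valid F ((A ▷ B) ∧' (B ▷ C) ⇒ A ▷ C))
                     → Valid F J2⁺
  J2-valid⇒J2⁺-valid J2-valid V w (p▷q∨r , q▷r) y wRy py with p▷q∨r y wRy py
  ... | z , ySz , inj₂ rz = z , ySz , rz
  ... | z , ySz , inj₁ qz =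
    J2-valid (var 0) (var 1) (var 2) V′ w (y▷z , z▷r) y wRy refl
    where
      V′ : ℕ → W → Set
      V′ zero          u = u ≡ y
      V′ (suc zero)    u = u ≡ z
      V′ (suc (suc n)) u = V (suc (suc n)) u

      y▷z : _,_⊩_ F V′ w (var 0 ▷ var 1)
      y▷z _ _ refl = z , ySz , refl

      z▷r : _,_⊩_ F V′ w (var 1 ▷ var 2)
      z▷r _ wRz refl = q▷r z wRz qz

BoolFun : ℕ → Set
BoolFun zero    = Bool
BoolFun (suc n) = Bool → BoolFun n

EveryAssignment : ∀ n → BoolFun n → Set
EveryAssignment zero    b = b ≡ true
EveryAssignment (suc n) f = ∀ b → EveryAssignment n (f b)

checkAll : ∀ n → BoolFun n → Bool
checkAll zero    b = b
checkAll (suc n) f = checkAll n (f true) ∧ checkAll n (f false)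

-- The exhaustive check is correct, so `decide n f refl` proves a
-- Boolean identity by computation.
decide : ∀ n f → checkAll n f ≡ true → EveryAssignment n f
decide zero    f ok       = ok
decide (suc n) f ok true  = decide n (f true)  (∧-conicalˡ _ _ ok)
decide (suc n) f ok false = decide n (f false) (∧-conicalʳ _ _ ok)

_⟹_ : Bool → Bool → Bool
p ⟹ q = not p ∨ q

⟹-mp : ∀ {p q} → (p ⟹ q) ≡ true → p ≡ true → q ≡ true
⟹-mp q≡true refl = q≡true

data Leaf : Set where
  a b c : Leaf

data Point : Set where
  root : Point
  leaf : Leaf → Point

box : Bool → Bool → Bool → Bool
box pa pb pc = pa ∧ pb ∧ pc

box-intro : ∀ {pa pb pc} → pa ≡ true → pb ≡ true → pc ≡ true → box pa pb pc ≡ true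
box-intro refl refl refl = refl

-- ▷ at the root, given the antecedent at a, b, c and the consequent at
-- b, c: each antecedent point forces the consequent on all its
-- S-successors, S(a) = {b,c}, S(b) = {c}, S(c) = {b,c}.
rhd : Bool → Bool → Bool → Bool → Bool → Bool
rhd Aa Ab Ac Bb Bc = (Aa ⟹ (Bb ∧ Bc)) ∧ (Ab ⟹ Bc) ∧ (Ac ⟹ (Bb ∧ Bc))

val : ℕ → Point → Bool
val 0 (leaf a) = true
val 1 (leaf b) = true
val 2 (leaf c) = true
val _ _        = false

ev : Point → Formula → Bool
ev w (var n)  = val n w
ev w ⊤'       = true
ev w ⊥'       = false
ev w (¬' A)   = not (ev w A)
ev w (A ∧' B) = ev w A ∧ ev w B
ev w (A ∨' B) = ev w A ∨ ev w B
ev w (A ⇒ B)  = ev w A ⟹ ev w B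
ev root     (□ A)   = box (ev (leaf a) A) (ev (leaf b) A) (ev (leaf c) A)
ev (leaf _) (□ A)   = true
ev root     (A ▷ B) = rhd (ev (leaf a) A) (ev (leaf b) A) (ev (leaf c) A)
                          (ev (leaf b) B) (ev (leaf c) B)
ev (leaf _) (A ▷ B) = true

ev-evalB : ∀ w A → evalB (ev w) A ≡ ev w A
ev-evalB w (var n)  = refl
ev-evalB w ⊤'       = refl
ev-evalB w ⊥'       = refl
ev-evalB w (¬' A)   = cong not (ev-evalB w A)
ev-evalB w (A ∧' B) = cong₂ _∧_ (ev-evalB w A) (ev-evalB w B)
ev-evalB w (A ∨' B) = cong₂ _∨_ (ev-evalB w A) (ev-evalB w B)
ev-evalB w (A ⇒ B)  = cong₂ _⟹_ (ev-evalB w A) (ev-evalB w B)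
ev-evalB w (□ A)    = refl
ev-evalB w (A ▷ B)  = refl

tautology-true : ∀ {A} → Tautology A → ∀ w → ev w A ≡ true
tautology-true {A} t w = trans (sym (ev-evalB w A)) (t (ev w))

-- The axioms and rules of IL⁻(J2, J4₊) at the root, as Boolean identities
-- in the truth values of the subformulas at the end points.

root-K : EveryAssignment 6 λ Aa Ab Ac Ba Bb Bc →
  box (Aa ⟹ Ba) (Ab ⟹ Bb) (Ac ⟹ Bc) ⟹ (box Aa Ab Ac ⟹ box Ba Bb Bc)
root-K = decide 6 _ refl

root-Löb : EveryAssignment 3 λ Aa Ab Ac →
  box (true ⟹ Aa) (true ⟹ Ab) (true ⟹ Ac) ⟹ box Aa Ab Ac
root-Löb = decide 3 _ refl

root-J3 : EveryAssignment 8 λ Aa Ab Ac Ba Bb Bc Cb Cc →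
  (rhd Aa Ab Ac Cb Cc ∧ rhd Ba Bb Bc Cb Cc) ⟹ rhd (Aa ∨ Ba) (Ab ∨ Bb) (Ac ∨ Bc) Cb Cc
root-J3 = decide 8 _ refl

root-J6 : EveryAssignment 3 λ Aa Ab Ac →
  (box Aa Ab Ac ⟹ rhd (not Aa) (not Ab) (not Ac) false false)
  ∧ (rhd (not Aa) (not Ab) (not Ac) false false ⟹ box Aa Ab Ac)
root-J6 = decide 3 _ refl

root-J2 : EveryAssignment 8 λ Aa Ab Ac Ba Bb Bc Cb Cc →
  (rhd Aa Ab Ac Bb Bc ∧ rhd Ba Bb Bc Cb Cc) ⟹ rhd Aa Ab Ac Cb Cc
root-J2 = decide 8 _ refl

root-J4₊ : EveryAssignment 9 λ Aa Ab Ac Bb Bc Ca Cb Cc Ba →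
  box (Aa ⟹ Ba) (Ab ⟹ Bb) (Ac ⟹ Bc) ⟹ (rhd Ca Cb Cc Ab Ac ⟹ rhd Ca Cb Cc Bb Bc)
root-J4₊ = decide 9 _ refl

-- ▷ at the root is monotone in the consequent (rule from A → B infer
-- C ▷ A → C ▷ B), needing the premise only at b and c ...
root-ruleR : EveryAssignment 7 λ Ca Cb Cc Ab Ac Bb Bc →
  ((Ab ⟹ Bb) ∧ (Ac ⟹ Bc)) ⟹ (rhd Ca Cb Cc Ab Ac ⟹ rhd Ca Cb Cc Bb Bc)
root-ruleR = decide 7 _ refl

root-ruleL : EveryAssignment 8 λ Aa Ab Ac Ba Bb Bc Cb Cc →
  ((Aa ⟹ Ba) ∧ (Ab ⟹ Bb) ∧ (Ac ⟹ Bc)) ⟹ (rhd Ba Bb Bc Cb Cc ⟹ rhd Aa Ab Ac Cb Cc)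
root-ruleL = decide 8 _ refl

-- The extra axioms J2, J4₊, J5 are true everywhere.  J5 is immediate:
-- ◇A is false at every end point, so (◇A) ▷ A holds vacuously at the root.
extra-true : ∀ {A} → J2J4+J5 A → ∀ w → ev w A ≡ true
extra-true (inj₁ (j2 A B C)) root = root-J2
  (ev (leaf a) A) (ev (leaf b) A) (ev (leaf c) A)
  (ev (leaf a) B) (ev (leaf b) B) (ev (leaf c) B) (ev (leaf b) C) (ev (leaf c) C)
extra-true (inj₁ (j2 A B C)) (leaf _) = refl
extra-true (inj₂ (inj₁ (j4+ A B C))) root = root-J4₊
  (ev (leaf a) A) (ev (leaf b) A) (ev (leaf c) A) (ev (leaf b) B) (ev (leaf c) B)
  (ev (leaf a) C) (ev (leaf b) C) (ev (leaf c) C) (ev (leaf a) B)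
extra-true (inj₂ (inj₁ (j4+ A B C))) (leaf _) = refl
extra-true (inj₂ (inj₂ (j5 A))) root     = refl
extra-true (inj₂ (inj₂ (j5 A))) (leaf _) = refl

sound : ∀ {A} → J2J4+J5 ⊢ A → ∀ w → ev w A ≡ true
sound (taut {A} t) w = tautology-true {A} t w
sound (extra e)    w = extra-true e w
sound (mp d e)     w = ⟹-mp (sound d w) (sound e w)
sound (axK {A} {B}) root = root-K
  (ev (leaf a) A) (ev (leaf b) A) (ev (leaf c) A) (ev (leaf a) B) (ev (leaf b) B) (ev (leaf c) B)
sound axK (leaf _) = refl
sound (axL {A}) root = root-Löb (ev (leaf a) A) (ev (leaf b) A) (ev (leaf c) A)
sound axL (leaf _) = refl
sound (axJ3 {A} {B} {C}) root = root-J3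
  (ev (leaf a) A) (ev (leaf b) A) (ev (leaf c) A)
  (ev (leaf a) B) (ev (leaf b) B) (ev (leaf c) B) (ev (leaf b) C) (ev (leaf c) C)
sound axJ3 (leaf _) = refl
sound (axJ6 {A}) root = root-J6 (ev (leaf a) A) (ev (leaf b) A) (ev (leaf c) A)
sound axJ6 (leaf _) = refl
sound (nec d) root = box-intro (sound d (leaf a)) (sound d (leaf b)) (sound d (leaf c))
sound (nec d) (leaf _) = refl
sound (ruleR {A} {B} {C} d) root = ⟹-mp
  (root-ruleR (ev (leaf a) C) (ev (leaf b) C) (ev (leaf c) C)
              (ev (leaf b) A) (ev (leaf c) A) (ev (leaf b) B) (ev (leaf c) B))
  (cong₂ _∧_ (sound d (leaf b)) (sound d (leaf c)))
sound (ruleR d) (leaf _) = refl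
sound (ruleL {A} {B} {C} d) root = ⟹-mp
  (root-ruleL (ev (leaf a) A) (ev (leaf b) A) (ev (leaf c) A)
              (ev (leaf a) B) (ev (leaf b) B) (ev (leaf c) B) (ev (leaf b) C) (ev (leaf c) C))
  (box-intro (sound d (leaf a)) (sound d (leaf b)) (sound d (leaf c)))
sound (ruleL d) (leaf _) = refl

-- J2⁺ fails at the root: p at a forces q ∨ r on b, c and q at b forces r
-- on c, but r fails at b ∈ S(a).
J2⁺-unprovable : ¬ (J2J4+J5 ⊢ J2⁺)
J2⁺-unprovable d with sound d root
... | ()

corollary6p2 : (L : Formula → Set)
    → (∀ A → ILm-J2 A → L A)
    → (∀ A → L A → ILm-J2J4+J5 A)
    → Σ Formula (λ A → ((F : Frame) → ValidSet F L → Valid F A) × ¬ L A)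
corollary6p2 L J2⊆L L⊆J2J4₊J5 = J2⁺ , valid-in-frames , J2⁺∉L
  where
    valid-in-frames : (F : Frame) → ValidSet F L → Valid F J2⁺
    valid-in-frames F L-valid = J2-valid⇒J2⁺-valid F
      λ A B C → L-valid _ (J2⊆L _ (extra (j2 A B C)))

    J2⁺∉L : ¬ L J2⁺
    J2⁺∉L J2⁺∈L = J2⁺-unprovable (L⊆J2J4₊J5 _ J2⁺∈L)
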